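{- For all processes $P,Q,P',Q'$: if $P\equiv Q$, $P\Rightarrow P'$ and $Q\Rightarrow Q'$, then $P'\equiv Q'$.
   Context: Processes. Base variables $x,y,z,\dots$ and channel names $a,b,c,\dots$; $v$ ranges over both. Expressions: $e ::= v \mid \mathtt{0} \mid \mathtt{s}(e) \mid [\,] \mid e::e' \mid \mathtt{tt} \mid \mathtt{ff}$. Processes: $P,Q ::= 0 \mid P\mid Q \mid\ !a(\vec v).P \mid a(\vec v).P \mid \overline{a}\langle \vec e\rangle \mid (\nu a)P \mid \mathtt{match}\ e\ \{\mathtt{0}\mapsto P;\ \mathtt{s}(x)\mapsto Q\} \mid \mathtt{match}\ e\ \{[\,]\mapsto P;\ x::y\mapsto Q\} \mid \mathtt{if}\ e\ \mathtt{then}\ P\ \mathtt{else}\ Q \mid \mathtt{tick}.P$. Structural congruence $\equiv$: the least congruence (equivalence relation closed under all constructors, including $\mathtt{tick}$) such that $P\mid0\equiv P$, $P\mid Q\equiv Q\mid P$, $P\mid(Q\mid R)\equiv(P\mid Q)\mid R$, $(\nu a)(\nu b)P\equiv(\nu b)(\nu a)P$, and $(\nu a)(P\mid Q)\equiv(\nu a)P\mid Q$ when $a$ is not free in $Q$. Time reduction $\Rightarrow$ is generated by: $0\Rightarrow0$; every process of the form $!a(\vec v).P$, $a(\vec v).P$, $\overline a\langle\vec e\rangle$, $\mathtt{match}\ e\ \{\dots\}$ or $\mathtt{if}\ e\ \mathtt{then}\ P\ \mathtt{else}\ Q$ reduces to itself; $\mathtt{tick}.P\Rightarrow P$; if $P\Rightarrow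 P'$ and $Q\Rightarrow Q'$ then $P\mid Q\Rightarrow P'\mid Q'$; if $P\Rightarrow P'$ then $(\nu a)P\Rightarrow(\nu a)P'$. -}

module Defs where

open import Data.Nat using (ℕ)
open import Data.List using (List)
open import Data.List.Membership.Propositional using (_∈_)
open import Data.List.Relation.Unary.Any using (Any)
open import Relation.Nullary using (¬_)
open import Relation.Binary.PropositionalEquality using (_≡_)

-- Base variables and channel names are two disjoint countable sorts;
-- v ranges over both.
data Name : Set where
  var  : ℕ → Name
  chan : ℕ → Name

data Expr : Set where
  nm    : Name → Expr
  zeroE : Expr
  sucE  : Expr → Expr
  nilE  : Expr
  consE : Expr → Expr → Expr
  ttE   : Expr
  ffE   : Expr

data Proc : Set where
  𝟘         : Proc
  _∣_       : Proc → Proc → Proc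
  repIn     : ℕ → List Name → Proc → Proc          -- !a(v⃗).P  (a a channel name)
  inp       : ℕ → List Name → Proc → Proc
  out       : ℕ → List Expr → Proc
  ν         : ℕ → Proc → Proc
  matchNat  : Expr → Proc → ℕ → Proc → Proc        -- match e {0 ↦ P; s(x) ↦ Q}
  matchList : Expr → Proc → ℕ → ℕ → Proc → Proc    -- match e {[] ↦ P; x::y ↦ Q}
  ite       : Expr → Proc → Proc → Proc
  tick      : Proc → Proc

data _∈ₑ_ (n : Name) : Expr → Set where
  here  : n ∈ₑ nm n
  sucₑ  : ∀ {e} → n ∈ₑ e → n ∈ₑ sucE e
  consˡ : ∀ {e e'} → n ∈ₑ e → n ∈ₑ consE e e'
  consʳ : ∀ {e e'} → n ∈ₑ e' → n ∈ₑ consE e e'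

data _∈fn_ (n : Name) : Proc → Set where
  parˡ   : ∀ {P Q} → n ∈fn P → n ∈fn (P ∣ Q)
  parʳ   : ∀ {P Q} → n ∈fn Q → n ∈fn (P ∣ Q)
  repSub : ∀ {a vs P} → n ≡ chan a → n ∈fn repIn a vs P
  repBod : ∀ {a vs P} → ¬ (n ∈ vs) → n ∈fn P → n ∈fn repIn a vs P
  inSub  : ∀ {a vs P} → n ≡ chan a → n ∈fn inp a vs P
  inBod  : ∀ {a vs P} → ¬ (n ∈ vs) → n ∈fn P → n ∈fn inp a vs P
  outSub : ∀ {a es} → n ≡ chan a → n ∈fn out a es
  outArg : ∀ {a es} → Any (n ∈ₑ_) es → n ∈fn out a es
  νBod   : ∀ {a P} → ¬ (n ≡ chan a) → n ∈fn P → n ∈fn ν a P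
  mnE    : ∀ {e P x Q} → n ∈ₑ e → n ∈fn matchNat e P x Q
  mnZ    : ∀ {e P x Q} → n ∈fn P → n ∈fn matchNat e P x Q
  mnS    : ∀ {e P x Q} → ¬ (n ≡ var x) → n ∈fn Q → n ∈fn matchNat e P x Q
  mlE    : ∀ {e P x y Q} → n ∈ₑ e → n ∈fn matchList e P x y Q
  mlN    : ∀ {e P x y Q} → n ∈fn P → n ∈fn matchList e P x y Q
  mlC    : ∀ {e P x y Q} → ¬ (n ≡ var x) → ¬ (n ≡ var y) → n ∈fn Q → n ∈fn matchList e P x y Q
  iteE   : ∀ {e P Q} → n ∈ₑ e → n ∈fn ite e P Q
  iteT   : ∀ {e P Q} → n ∈fn P → n ∈fn ite e P Q
  iteF   : ∀ {e P Q} → n ∈fn Q → n ∈fn ite e P Q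
  tickB  : ∀ {P} → n ∈fn P → n ∈fn tick P

infix 4 _≡ₛ_ _⇒_
infixr 6 _∣_

data _≡ₛ_ : Proc → Proc → Set where
  refl  : ∀ {P} → P ≡ₛ P
  sym   : ∀ {P Q} → P ≡ₛ Q → Q ≡ₛ P
  trans : ∀ {P Q R} → P ≡ₛ Q → Q ≡ₛ R → P ≡ₛ R
  par-unit  : ∀ {P} → (P ∣ 𝟘) ≡ₛ P
  par-comm  : ∀ {P Q} → (P ∣ Q) ≡ₛ (Q ∣ P)
  par-assoc : ∀ {P Q R} → (P ∣ (Q ∣ R)) ≡ₛ ((P ∣ Q) ∣ R)
  ν-swap    : ∀ {a b P} → ν a (ν b P) ≡ₛ ν b (ν a P)
  ν-extr    : ∀ {a P Q} → ¬ (chan a ∈fn Q) → ν a (P ∣ Q) ≡ₛ (ν a P ∣ Q)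
  c-par   : ∀ {P P' Q Q'} → P ≡ₛ P' → Q ≡ₛ Q' → (P ∣ Q) ≡ₛ (P' ∣ Q')
  c-rep   : ∀ {a vs P P'} → P ≡ₛ P' → repIn a vs P ≡ₛ repIn a vs P'
  c-inp   : ∀ {a vs P P'} → P ≡ₛ P' → inp a vs P ≡ₛ inp a vs P'
  c-ν     : ∀ {a P P'} → P ≡ₛ P' → ν a P ≡ₛ ν a P'
  c-mnat  : ∀ {e P P' x Q Q'} → P ≡ₛ P' → Q ≡ₛ Q' → matchNat e P x Q ≡ₛ matchNat e P' x Q'
  c-mlist : ∀ {e P P' x y Q Q'} → P ≡ₛ P' → Q ≡ₛ Q' → matchList e P x y Q ≡ₛ matchList e P' x y Q'
  c-ite   : ∀ {e P P' Q Q'} → P ≡ₛ P' → Q ≡ₛ Q' → ite e P Q ≡ₛ ite e P' Q'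
  c-tick  : ∀ {P P'} → P ≡ₛ P' → tick P ≡ₛ tick P'

data _⇒_ : Proc → Proc → Set where
  t-zero  : 𝟘 ⇒ 𝟘
  t-rep   : ∀ {a vs P} → repIn a vs P ⇒ repIn a vs P
  t-inp   : ∀ {a vs P} → inp a vs P ⇒ inp a vs P
  t-out   : ∀ {a es} → out a es ⇒ out a es
  t-mnat  : ∀ {e P x Q} → matchNat e P x Q ⇒ matchNat e P x Q
  t-mlist : ∀ {e P x y Q} → matchList e P x y Q ⇒ matchList e P x y Q
  t-ite   : ∀ {e P Q} → ite e P Q ⇒ ite e P Q
  t-tick  : ∀ {P} → tick P ⇒ P
  t-par   : ∀ {P P' Q Q'} → P ⇒ P' → Q ⇒ Q' → (P ∣ Q) ⇒ (P' ∣ Q')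
  t-ν     : ∀ {a P P'} → P ⇒ P' → ν a P ⇒ ν a P'

-- Time reduction is the graph of a function: `elapse` removes the outermost
-- ticks that are not guarded by a prefix, match or conditional. So it suffices
-- that `elapse` maps congruent processes to congruent processes; the only
-- non-trivial case is scope extrusion, whose side condition survives because
-- `elapse` cannot create free names.
module Submission where

open import Defs
open import Relation.Binary.PropositionalEquality as Eq using (_≡_; cong; cong₂; subst₂)

elapse : Proc → Proc
elapse 𝟘                     = 𝟘
elapse (P ∣ Q)               = elapse P ∣ elapse Q
elapse (repIn a vs P)        = repIn a vs P
elapse (inp a vs P)          = inp a vs P
elapse (out a es)            = out a es
elapse (ν a P)               = ν a (elapse P)
elapse (matchNat e P x Q)    = matchNat e P x Q
elapse (matchList e P x y Q) = matchList e P x y Q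
elapse (ite e P Q)           = ite e P Q
elapse (tick P)              = P

⇒-elapse : ∀ {P P'} → P ⇒ P' → P' ≡ elapse P
⇒-elapse t-zero      = Eq.refl
⇒-elapse t-rep       = Eq.refl
⇒-elapse t-inp       = Eq.refl
⇒-elapse t-out       = Eq.refl
⇒-elapse t-mnat      = Eq.refl
⇒-elapse t-mlist     = Eq.refl
⇒-elapse t-ite       = Eq.refl
⇒-elapse t-tick      = Eq.refl
⇒-elapse (t-par p q) = cong₂ _∣_ (⇒-elapse p) (⇒-elapse q)
⇒-elapse (t-ν p)     = cong (ν _) (⇒-elapse p)

∈fn-elapse⁻ : ∀ {n} P → n ∈fn elapse P → n ∈fn P
∈fn-elapse⁻ 𝟘                     n∈ = n∈
∈fn-elapse⁻ (P ∣ Q)               (parˡ n∈) = parˡ (∈fn-elapse⁻ P n∈)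
∈fn-elapse⁻ (P ∣ Q)               (parʳ n∈) = parʳ (∈fn-elapse⁻ Q n∈)
∈fn-elapse⁻ (repIn a vs P)        n∈ = n∈
∈fn-elapse⁻ (inp a vs P)          n∈ = n∈
∈fn-elapse⁻ (out a es)            n∈ = n∈
∈fn-elapse⁻ (ν a P)               (νBod n≢a n∈) = νBod n≢a (∈fn-elapse⁻ P n∈)
∈fn-elapse⁻ (matchNat e P x Q)    n∈ = n∈
∈fn-elapse⁻ (matchList e P x y Q) n∈ = n∈
∈fn-elapse⁻ (ite e P Q)           n∈ = n∈
∈fn-elapse⁻ (tick P)              n∈ = tickB n∈

elapse-cong : ∀ {P Q} → P ≡ₛ Q → elapse P ≡ₛ elapse Q
elapse-cong refl                  = refl
elapse-cong (sym p)               = sym (elapse-cong p)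
elapse-cong (trans p q)           = trans (elapse-cong p) (elapse-cong q)
elapse-cong par-unit              = par-unit
elapse-cong par-comm              = par-comm
elapse-cong par-assoc             = par-assoc
elapse-cong ν-swap                = ν-swap
elapse-cong (ν-extr {Q = Q} a∉Q)  = ν-extr (λ a∈ → a∉Q (∈fn-elapse⁻ Q a∈))
elapse-cong (c-par p q)           = c-par (elapse-cong p) (elapse-cong q)
elapse-cong (c-rep p)             = c-rep p
elapse-cong (c-inp p)             = c-inp p
elapse-cong (c-ν p)               = c-ν (elapse-cong p)
elapse-cong (c-mnat p q)          = c-mnat p q
elapse-cong (c-mlist p q)         = c-mlist p q
elapse-cong (c-ite p q)           = c-ite p q
elapse-cong (c-tick p)            = p

lemma3p1 : ∀ {P Q P' Q'} → P ≡ₛ Q → P ⇒ P' → Q ⇒ Q' → P' ≡ₛ Q'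
lemma3p1 P≡ₛQ P⇒P' Q⇒Q' =
  subst₂ _≡ₛ_ (Eq.sym (⇒-elapse P⇒P')) (Eq.sym (⇒-elapse Q⇒Q')) (elapse-cong P≡ₛQ)
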